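{- Insert a sequence of $2^k$ values one at a time into an initially empty black-white array (as defined in the context), and consider the associated BWA merge tree. Then the chronological order in which the nodes of the merge tree are processed (a leaf when its value is inserted, an internal node when the merge it represents is performed) is a post-order traversal of the tree.
   Context: Black-white array (BWA): a white array $W$ and a black array $B$ (half the length), each divided into segments, the segment of rank $j$ being the index range $[2^j,2^{j+1}-1]$. A counter $\mathtt{total}$ records the number of stored values, and the segment of rank $i$ is active iff bit $i$ of $\mathtt{total}$ is $1$. Insertion of $v$: if rank $0$ is inactive put $v$ in $W[1]$; otherwise put $v$ in $B[1]$ and perform merge of rank $0$, where merge of rank $i$ merges the sorted black and white segments of rank $i$ and writes the result to the white segment of rank $i+1$ if that segment is inactive, and otherwise to the black segment of rank $i+1$ followed by merge of rank $i+1$; afterwards $\mathtt{total}$ increases by one. BWA merge tree for $2^k$ insertions: a complete binary tree of height $k$ whose leaves, from left to right, are the inserted values in insertion order; an internal node at height $j+1$ represents the merge of the two rank-$j$ segments represented by its two children (the left child's content being in the white segment and the right child's in the black segment at the time of the merge). -}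

module Defs where

open import Data.Nat using (ℕ; zero; suc; _+_; _^_)
open import Data.Bool using (Bool; if_then_else_)
open import Data.List using (List; []; _∷_; _++_; [_])
open import Data.Maybe using (Maybe; just; nothing)
open import Data.Product using (_×_; _,_; proj₁; proj₂)

-- Binary trees whose leaves carry (insertion index, value).
-- The insertion index makes every node of a merge tree uniquely identifiable
-- by its subtree, even when values repeat.
data Tree (A : Set) : Set where
  leaf : ℕ → A → Tree A
  node : Tree A → Tree A → Tree A

postorder : {A : Set} → Tree A → List (Tree A)
postorder (leaf i a)  = [ leaf i a ]
postorder (node l r) = postorder l ++ postorder r ++ [ node l r ]

-- The BWA merge tree for 2^k insertions of the values v 0, v 1, …:
-- complete binary tree of height k; the subtree of height j starting at
-- leaf position i covers the values inserted at positions i .. i + 2^j - 1.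
mergeTree : {A : Set} → (ℕ → A) → (j : ℕ) → (i : ℕ) → Tree A
mergeTree v zero    i = leaf i (v i)
mergeTree v (suc j) i = node (mergeTree v j i) (mergeTree v j (i + 2 ^ j))

module BWA {A : Set} (_≤ᵇ_ : A → A → Bool) where

  merge : List A → List A → List A
  merge []       ys       = ys
  merge (x ∷ xs) []       = x ∷ xs
  merge (x ∷ xs) (y ∷ ys) =
    if x ≤ᵇ y then x ∷ merge xs (y ∷ ys) else y ∷ merge (x ∷ xs) ys

  -- Content of a segment: its sorted values, together with the node of the
  -- merge tree that the segment represents.
  record Seg : Set where
    constructor seg
    field
      vals : List A
      tree : Tree A
  open Seg public

  -- The white array, indexed by rank: entry i is `just s` iff the white
  -- segment of rank i is active (i.e. bit i of total is 1) with content s,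
  -- and `nothing` iff it is inactive.  Thus `total` is the number whose
  -- binary digits (least significant first) are the activity flags.
  State : Set
  State = List (Maybe Seg)

  total : State → ℕ
  total []              = 0
  total (nothing ∷ st) = 2 * total st where open Data.Nat using (_*_)
  total (just _ ∷ st)  = suc (2 * total st) where open Data.Nat using (_*_)

  mergeSeg : Seg → Seg → Seg
  mergeSeg w b = seg (merge (vals w) (vals b)) (node (tree w) (tree b))

  -- A segment s has been produced for the current rank (the first entry of st).
  -- If that white segment is inactive, s is written there; otherwise s goes to
  -- the black segment and the merge of that rank is performed (recorded as an
  -- event: the merge-tree node it represents), its result being passed on to
  -- the next rank.  All ranks through which a merge passes become inactive,
  -- which is exactly the effect of incrementing total.
  place : Seg → State → State × List (Tree A)
  place s []               = (just s ∷ [] , [])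
  place s (nothing ∷ st)  = (just s ∷ st , [])
  place s (just w ∷ st)   =
    let m = mergeSeg w s
        r = place m st
    in (nothing ∷ proj₁ r , tree m ∷ proj₂ r)

  insert : ℕ → A → State → State × List (Tree A)
  insert n a st =
    let r = place (seg [ a ] (leaf n a)) st
    in (proj₁ r , leaf n a ∷ proj₂ r)

  run : (ℕ → A) → ℕ → State × List (Tree A)
  run v zero    = ([] , [])
  run v (suc n) =
    let r  = run v n
        r' = insert n (v n) (proj₁ r)
    in (proj₁ r' , proj₂ r ++ proj₂ r')

  events : (ℕ → A) → ℕ → List (Tree A)
  events v n = proj₂ (run v n)

module Submission where

-- A subtree of the merge tree of height j whose leaves are the
-- insertions i, …, i + 2^j - 1 is "built" by exactly those insertions: if the
-- ranks 0 … j-1 are inactive beforehand, the 2^j insertions log the post-order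
-- traversal of the subtree and then hand the segment representing its root on
-- to rank j, as if that segment had been placed there directly (lemma
-- `run-subtree`, by induction on j: the left half leaves its root white at
-- rank j, the right half's root then meets it and triggers the merge that the
-- root node represents).
--
-- Since `run` starts from the empty array rather than from an
-- array with k inactive ranks, we also show that every step is insensitive to
-- padding a state with inactive ranks at the top.  The theorem is the case
-- j = k, i = 0 of `run-subtree`, started from the padded empty array.

open import Defs
open import Data.Nat using (ℕ; zero; suc; _+_; _^_)
open import Data.Nat.Properties using (+-suc; +-assoc; +-identityʳ)
open import Data.Bool using (Bool)
open import Data.Maybe using (just; nothing)
open import Data.List using (List; []; _∷_; _++_; [_])
open import Data.List.Properties using (++-assoc; ++-identityʳ)
open import Data.Product using (_×_; _,_; proj₁; proj₂)
open import Relation.Binary.PropositionalEquality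
  using (_≡_; refl; sym; cong; cong₂; module ≡-Reasoning)

module Steps {A : Set} (_≤ᵇ_ : A → A → Bool) where
  open BWA _≤ᵇ_

  Step : Set
  Step = State → State × List (Tree A)

  infixl 5 _⨾_
  _⨾_ : Step → Step → Step
  (f ⨾ g) st = proj₁ (g (proj₁ (f st))) , proj₂ (f st) ++ proj₂ (g (proj₁ (f st)))

  ⨾-first : ∀ (f g : Step) {st r} → f st ≡ r →
    (f ⨾ g) st ≡ (proj₁ (g (proj₁ r)) , proj₂ r ++ proj₂ (g (proj₁ r)))
  ⨾-first f g refl = refl

  ⨾-assoc : ∀ (f g h : Step) st → ((f ⨾ g) ⨾ h) st ≡ (f ⨾ (g ⨾ h)) st
  ⨾-assoc f g h st = cong (proj₁ ((f ⨾ g ⨾ h) st) ,_)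
    (++-assoc (proj₂ (f st)) (proj₂ (g (proj₁ (f st))))
              (proj₂ (h (proj₁ ((f ⨾ g) st)))))

  -- `st ≼ st'`: st' is st with some inactive ranks appended at the top.
  -- Such arrays represent the same BWA (the same value of total).
  infix 4 _≼_
  data _≼_ : State → State → Set where
    empty    : [] ≼ []
    inactive : ∀ {st} → [] ≼ st → [] ≼ nothing ∷ st
    same     : ∀ {x st st'} → st ≼ st' → x ∷ st ≼ x ∷ st'

  PaddingInvariant : Step → Set
  PaddingInvariant f = ∀ {st st'} → st ≼ st' →
    proj₁ (f st) ≼ proj₁ (f st') × proj₂ (f st) ≡ proj₂ (f st')

  ⨾-padding-invariant : ∀ {f g} → PaddingInvariant f → PaddingInvariant g →
    PaddingInvariant (f ⨾ g)
  ⨾-padding-invariant pf pg p with pf p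
  ... | q , ef with pg q
  ...   | q′ , eg = q′ , cong₂ _++_ ef eg

  -- Placing a segment at rank 0 ignores inactive top ranks: an inactive
  -- rank and a missing rank both simply receive the segment.
  place-padding-invariant : ∀ s → PaddingInvariant (place s)
  place-padding-invariant s empty               = same empty , refl
  place-padding-invariant s (inactive p)        = same p , refl
  place-padding-invariant s (same {nothing} p)  = same p , refl
  place-padding-invariant s (same {just w} p)
    with place-padding-invariant (mergeSeg w s) p
  ... | q , e = same q , cong (tree (mergeSeg w s) ∷_) e

  insert-padding-invariant : ∀ n a → PaddingInvariant (insert n a)
  insert-padding-invariant n a p
    with place-padding-invariant (seg [ a ] (leaf n a)) p
  ... | q , e = q , cong (leaf n a ∷_) e

  pad : ℕ → State → State
  pad zero    st = st
  pad (suc j) st = pad j (nothing ∷ st)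

  pad-of-empty : ∀ j {st} → [] ≼ st → [] ≼ pad j st
  pad-of-empty zero    p = p
  pad-of-empty (suc j) p = pad-of-empty j (inactive p)

module Insertions {A : Set} (_≤ᵇ_ : A → A → Bool) (v : ℕ → A) where
  open BWA _≤ᵇ_
  open Steps _≤ᵇ_
  open ≡-Reasoning

  runFrom : ℕ → ℕ → Step
  runFrom i zero    st = st , []
  runFrom i (suc n)    = runFrom i n ⨾ insert (i + n) (v (i + n))

  run≡runFrom : ∀ n → run v n ≡ runFrom 0 n []
  run≡runFrom zero = refl
  run≡runFrom (suc n) rewrite run≡runFrom n = refl

  runFrom-+ : ∀ i m n st → runFrom i (m + n) st ≡ (runFrom i m ⨾ runFrom (i + m) n) st
  runFrom-+ i m zero st rewrite +-identityʳ m =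
    cong (proj₁ (runFrom i m st) ,_) (sym (++-identityʳ _))
  runFrom-+ i m (suc n) st rewrite +-suc m n | sym (+-assoc i m n) = begin
    (runFrom i (m + n) ⨾ ins) st
      ≡⟨ ⨾-first (runFrom i (m + n)) ins (runFrom-+ i m n st) ⟩
    (runFrom i m ⨾ runFrom (i + m) n ⨾ ins) st
      ≡⟨ ⨾-assoc (runFrom i m) (runFrom (i + m) n) ins st ⟩
    (runFrom i m ⨾ (runFrom (i + m) n ⨾ ins)) st
      ∎
    where ins = insert (i + m + n) (v (i + m + n))

  runFrom-padding-invariant : ∀ i n → PaddingInvariant (runFrom i n)
  runFrom-padding-invariant i zero    p = p , refl
  runFrom-padding-invariant i (suc n) =
    ⨾-padding-invariant (runFrom-padding-invariant i n)
                        (insert-padding-invariant (i + n) (v (i + n)))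

  contents : ℕ → ℕ → List A
  contents zero    i = [ v i ]
  contents (suc j) i = merge (contents j i) (contents j (i + 2 ^ j))

  subtreeSeg : ℕ → ℕ → Seg
  subtreeSeg j i = seg (contents j i) (mergeTree v j i)

  postorder-node : ∀ (l r : Tree A) rest →
    (postorder l ++ []) ++ (postorder r ++ node l r ∷ rest)
      ≡ postorder (node l r) ++ rest
  postorder-node l r rest = begin
    (postorder l ++ []) ++ (postorder r ++ node l r ∷ rest)
      ≡⟨ cong (_++ (postorder r ++ node l r ∷ rest)) (++-identityʳ (postorder l)) ⟩
    postorder l ++ (postorder r ++ [ node l r ] ++ rest)
      ≡⟨ cong (postorder l ++_) (sym (++-assoc (postorder r) [ node l r ] rest)) ⟩
    postorder l ++ ((postorder r ++ [ node l r ]) ++ rest)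
      ≡⟨ sym (++-assoc (postorder l) (postorder r ++ [ node l r ]) rest) ⟩
    postorder (node l r) ++ rest
      ∎

  run-subtree : ∀ j i rest →
    runFrom i (2 ^ j) (pad j rest)
      ≡ (pad j (proj₁ (place (subtreeSeg j i) rest)) ,
         postorder (mergeTree v j i) ++ proj₂ (place (subtreeSeg j i) rest))
  run-subtree zero i rest rewrite +-identityʳ i = refl
  run-subtree (suc j) i rest = begin
    runFrom i (2 ^ suc j) (pad j (nothing ∷ rest))
      ≡⟨ cong (λ n → runFrom i (h + n) (pad j (nothing ∷ rest))) (+-identityʳ h) ⟩
    runFrom i (h + h) (pad j (nothing ∷ rest))
      ≡⟨ runFrom-+ i h h (pad j (nothing ∷ rest)) ⟩
    (runFrom i h ⨾ runFrom (i + h) h) (pad j (nothing ∷ rest))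
      ≡⟨ ⨾-first (runFrom i h) (runFrom (i + h) h) (run-subtree j i (nothing ∷ rest)) ⟩
    (proj₁ right , (postorder l ++ []) ++ proj₂ right)
      ≡⟨ cong (λ r → proj₁ r , (postorder l ++ []) ++ proj₂ r)
              (run-subtree j (i + h) (just (subtreeSeg j i) ∷ rest)) ⟩
    (pad (suc j) (proj₁ root) ,
     (postorder l ++ []) ++ (postorder r ++ node l r ∷ proj₂ root))
      ≡⟨ cong (pad (suc j) (proj₁ root) ,_) (postorder-node l r (proj₂ root)) ⟩
    (pad (suc j) (proj₁ root) , postorder (node l r) ++ proj₂ root)
      ∎
    where
    h     = 2 ^ j
    l     = mergeTree v j i
    r     = mergeTree v j (i + h)
    right = runFrom (i + h) h (pad j (just (subtreeSeg j i) ∷ rest))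
    root  = place (subtreeSeg (suc j) i) rest

mainTheorem5 : {A : Set} (_≤ᵇ_ : A → A → Bool) (k : ℕ) (v : ℕ → A) →
    BWA.events _≤ᵇ_ v (2 ^ k) ≡ postorder (mergeTree v k 0)
mainTheorem5 _≤ᵇ_ k v = begin
  BWA.events _≤ᵇ_ v (2 ^ k)
    ≡⟨ cong proj₂ (run≡runFrom (2 ^ k)) ⟩
  proj₂ (runFrom 0 (2 ^ k) [])
    ≡⟨ proj₂ (runFrom-padding-invariant 0 (2 ^ k) (pad-of-empty k empty)) ⟩
  proj₂ (runFrom 0 (2 ^ k) (pad k []))
    ≡⟨ cong proj₂ (run-subtree k 0 []) ⟩
  postorder (mergeTree v k 0) ++ []
    ≡⟨ ++-identityʳ _ ⟩
  postorder (mergeTree v k 0)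
    ∎
  where
  open Steps _≤ᵇ_
  open Insertions _≤ᵇ_ v
  open ≡-Reasoning
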